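{- Let $\Gamma,\Delta$ be finite sequences of $2$PC formulas and $\Gamma_1,\Delta_1$ finite sequences of PC formulas. Then: (1) $\Gamma\models_1\Delta$ iff $\Gamma^\bullet\models\Delta^\bullet$, and $\Gamma_1\models\Delta_1$ iff $\Gamma_1^\circ\models_1\Delta_1^\circ$; (2) $\Gamma\vdash_1\Delta$ is provable in $2$PC iff $\Gamma^\bullet\vdash\Delta^\bullet$ is provable in the PC sequent calculus, and $\Gamma_1\vdash\Delta_1$ is provable in the PC sequent calculus iff $\Gamma_1^\circ\vdash_1\Delta_1^\circ$ is provable in $2$PC.
   Context: $2$PC: formulas are decorated variables $X^{id},X^{(12)}$ ($X\in V$, $V$ a countable set of variables, $S_2=\{id,(12)\}$), constants $\mathsf e_1,\mathsf e_2$, and $q(F,G_1,G_2)$. For $\rho\in S_2$: $(X^\pi)^\rho=X^{\rho\circ\pi}$, $(\mathsf e_k)^\rho=\mathsf e_{\rho(k)}$, $q(F,G_1,G_2)^\rho=q(F,G_1^\rho,G_2^\rho)$; $(ij)$ is the transposition of $i,j$ (identity if $i=j$); $\Gamma^\rho$ elementwise. Sequents $\Gamma\vdash_i\Delta$ ($i\in\{1,2\}$, $\Gamma,\Delta$ finite multisets) are provable if derivable by (premises $\Rightarrow$ conclusion), for all $i,j,k\in\{1,2\}$: (Const) $\Rightarrow\vdash_i\mathsf e_i$; (Id) $\Rightarrow X^\pi\vdash_i X^\rho$ if $\pi^{ -1}(i)=\rho^{ -1}(i)$; (Sym) $\Gamma^{(ij)}\vdash_i\Delta^{(ij)}\Rightarrow\Gamma\vdash_j\Delta$;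 (Neg1) if $i\neq k$: $\Gamma^{(ij)}\vdash_iF,\Delta^{(ij)}\Rightarrow\Gamma,F^{(jk)}\vdash_j\Delta$; (Neg2) if $j\neq k$: $\Gamma^{(ij)}\vdash_iF,\Delta^{(ij)}\Rightarrow\Gamma,F^{(ik)}\vdash_j\Delta$; (Neg3) $\{\Gamma^{(ij)},F\vdash_i\Delta^{(ij)}\}_{i\ne j}\Rightarrow\Gamma\vdash_jF,\Delta$; (qL) $\{\Gamma^{(ji)},F,G_j^{(ji)}\vdash_j\Delta^{(ji)}\}_{j\in\{1,2\}}\Rightarrow\Gamma,q(F,G_1,G_2)\vdash_i\Delta$; (qR) $\{\Gamma^{(ji)},F\vdash_jG_j^{(ji)},\Delta^{(ji)}\}_{j\in\{1,2\}}\Rightarrow\Gamma\vdash_iq(F,G_1,G_2),\Delta$; Cut, weakening and contraction on both sides. Semantics: for $v:V\to\{1,2\}$, $[\![X^\pi]\!]_v=\pi(v(X))$, $[\![\mathsf e_i]\!]_v=i$, $[\![q(F,G_1,G_2)]\!]_v=[\![G_k]\!]_v$ with $k=[\![F]\!]_v$; $\Gamma\models_1\Delta$ means every $v$ giving value $1$ to all of $\Gamma$ gives value $1$ to some member of $\Delta$. PC: formulas built from $0,1$, variables in $V$, $\neg,\wedge,\vee$; $\Gamma_1\models\Delta_1$ means every classical valuation making all of $\Gamma_1$ true makes some member of $\Delta_1$ true. The PC sequent calculus has rules: $\Rightarrow\ \vdash 1$; $\Rightarrow 0\vdash$; $\Rightarrow P\vdash P$; $\Gamma,P,Q\vdash\Delta\Rightarrow\Gamma,P\wedge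 Q\vdash\Delta$; $\Gamma\vdash P,\Delta$ and $\Gamma\vdash Q,\Delta\Rightarrow\Gamma\vdash P\wedge Q,\Delta$; $\Gamma,P\vdash\Delta$ and $\Gamma,Q\vdash\Delta\Rightarrow\Gamma,P\vee Q\vdash\Delta$; $\Gamma\vdash P,Q,\Delta\Rightarrow\Gamma\vdash P\vee Q,\Delta$; $\Gamma\vdash P,\Delta\Rightarrow\Gamma,\neg P\vdash\Delta$; $\Gamma,P\vdash\Delta\Rightarrow\Gamma\vdash\neg P,\Delta$; Cut, weakening and contraction on both sides. Translations: $0^\circ=\mathsf e_2$, $1^\circ=\mathsf e_1$, $X^\circ=X^{id}$, $(\neg P)^\circ=(P^\circ)^{(12)}$, $(P\wedge Q)^\circ=q(P^\circ,Q^\circ,\mathsf e_2)$, $(P\vee Q)^\circ=q(P^\circ,\mathsf e_1,Q^\circ)$; $\mathsf e_2^\bullet=0$, $\mathsf e_1^\bullet=1$, $(X^{id})^\bullet=X$, $(X^{(12)})^\bullet=\neg X$, $q(F,G,H)^\bullet=(F^\bullet\wedge G^\bullet)\vee(\neg F^\bullet\wedge H^\bullet)$; extended elementwise to sequences. -}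

module Defs where

open import Data.Nat using (ℕ)
open import Data.Bool using (Bool; true; false; not; _∧_; _∨_)
open import Data.List using (List; []; _∷_; map)
open import Data.List.Relation.Unary.All using (All)
open import Data.List.Relation.Unary.Any using (Any)
open import Data.List.Relation.Binary.Permutation.Propositional using (_↭_)
open import Relation.Binary.PropositionalEquality using (_≡_)
open import Relation.Nullary using (¬_)

data Two : Set where
  one two : Two

data Perm : Set where
  pid swp : Perm

act : Perm → Two → Two
act pid k   = k
act swp one = two
act swp two = one

_∘ₚ_ : Perm → Perm → Perm
pid ∘ₚ π = π
swp ∘ₚ pid = swp
swp ∘ₚ swp = pid

inv : Perm → Perm
inv pid = pid
inv swp = swp

tr : Two → Two → Perm
tr one one = pid
tr two two = pid
tr one two = swp
tr two one = swp

data Fm : Set where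
  var : ℕ → Perm → Fm
  e   : Two → Fm
  q   : Fm → Fm → Fm → Fm

_^_ : Fm → Perm → Fm
var X π ^ ρ = var X (ρ ∘ₚ π)
e k ^ ρ = e (act ρ k)
q F G₁ G₂ ^ ρ = q F (G₁ ^ ρ) (G₂ ^ ρ)

_^ˢ_ : List Fm → Perm → List Fm
Γ ^ˢ ρ = map (_^ ρ) Γ

pick : {A : Set} → Two → A → A → A
pick one G₁ G₂ = G₁
pick two G₁ G₂ = G₂

-- 2PC sequent calculus; sequences with an exchange rule represent multisets;
-- "Γ , F" is rendered as F ∷ Γ.
data _⊢[_]_ : List Fm → Two → List Fm → Set where
  Const : ∀ {i} → [] ⊢[ i ] (e i ∷ [])
  Id    : ∀ {i X π ρ} → act (inv π) i ≡ act (inv ρ) i →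
          (var X π ∷ []) ⊢[ i ] (var X ρ ∷ [])
  Sym   : ∀ {i j Γ Δ} → (Γ ^ˢ tr i j) ⊢[ i ] (Δ ^ˢ tr i j) → Γ ⊢[ j ] Δ
  Neg1  : ∀ {i j k Γ Δ F} → ¬ (i ≡ k) →
          (Γ ^ˢ tr i j) ⊢[ i ] (F ∷ (Δ ^ˢ tr i j)) →
          ((F ^ tr j k) ∷ Γ) ⊢[ j ] Δ
  Neg2  : ∀ {i j k Γ Δ F} → ¬ (j ≡ k) →
          (Γ ^ˢ tr i j) ⊢[ i ] (F ∷ (Δ ^ˢ tr i j)) →
          ((F ^ tr i k) ∷ Γ) ⊢[ j ] Δ
  Neg3  : ∀ {j Γ Δ F} →
          (∀ i → ¬ (i ≡ j) → (F ∷ (Γ ^ˢ tr i j)) ⊢[ i ] (Δ ^ˢ tr i j)) →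
          Γ ⊢[ j ] (F ∷ Δ)
  qL    : ∀ {i Γ Δ F G₁ G₂} →
          (∀ j → ((pick j G₁ G₂ ^ tr j i) ∷ F ∷ (Γ ^ˢ tr j i)) ⊢[ j ] (Δ ^ˢ tr j i)) →
          (q F G₁ G₂ ∷ Γ) ⊢[ i ] Δ
  qR    : ∀ {i Γ Δ F G₁ G₂} →
          (∀ j → (F ∷ (Γ ^ˢ tr j i)) ⊢[ j ] ((pick j G₁ G₂ ^ tr j i) ∷ (Δ ^ˢ tr j i))) →
          Γ ⊢[ i ] (q F G₁ G₂ ∷ Δ)
  Cut   : ∀ {i Γ Δ F} → Γ ⊢[ i ] (F ∷ Δ) → (F ∷ Γ) ⊢[ i ] Δ → Γ ⊢[ i ] Δ
  WL    : ∀ {i Γ Δ F} → Γ ⊢[ i ] Δ → (F ∷ Γ) ⊢[ i ] Δ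
  WR    : ∀ {i Γ Δ F} → Γ ⊢[ i ] Δ → Γ ⊢[ i ] (F ∷ Δ)
  CL    : ∀ {i Γ Δ F} → (F ∷ F ∷ Γ) ⊢[ i ] Δ → (F ∷ Γ) ⊢[ i ] Δ
  CR    : ∀ {i Γ Δ F} → Γ ⊢[ i ] (F ∷ F ∷ Δ) → Γ ⊢[ i ] (F ∷ Δ)
  ExL   : ∀ {i Γ Γ' Δ} → Γ ↭ Γ' → Γ ⊢[ i ] Δ → Γ' ⊢[ i ] Δ
  ExR   : ∀ {i Γ Δ Δ'} → Δ ↭ Δ' → Γ ⊢[ i ] Δ → Γ ⊢[ i ] Δ'

⟦_⟧ : Fm → (ℕ → Two) → Two
⟦ var X π ⟧ v = act π (v X)
⟦ e i ⟧ v = i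
⟦ q F G₁ G₂ ⟧ v = pick (⟦ F ⟧ v) (⟦ G₁ ⟧ v) (⟦ G₂ ⟧ v)

_⊨₁_ : List Fm → List Fm → Set
Γ ⊨₁ Δ = ∀ (v : ℕ → Two) →
  All (λ F → ⟦ F ⟧ v ≡ one) Γ → Any (λ G → ⟦ G ⟧ v ≡ one) Δ

data PFm : Set where
  𝟘 𝟙 : PFm
  pv  : ℕ → PFm
  ¬ₚ  : PFm → PFm
  _∧ₚ_ _∨ₚ_ : PFm → PFm → PFm

evalₚ : (ℕ → Bool) → PFm → Bool
evalₚ v 𝟘 = false
evalₚ v 𝟙 = true
evalₚ v (pv X) = v X
evalₚ v (¬ₚ P) = not (evalₚ v P)
evalₚ v (P ∧ₚ Q) = evalₚ v P ∧ evalₚ v Q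
evalₚ v (P ∨ₚ Q) = evalₚ v P ∨ evalₚ v Q

_⊨_ : List PFm → List PFm → Set
Γ ⊨ Δ = ∀ (v : ℕ → Bool) →
  All (λ P → evalₚ v P ≡ true) Γ → Any (λ P → evalₚ v P ≡ true) Δ

data _⊢ₚ_ : List PFm → List PFm → Set where
  ⊢𝟙   : [] ⊢ₚ (𝟙 ∷ [])
  𝟘⊢   : (𝟘 ∷ []) ⊢ₚ []
  ax   : ∀ {P} → (P ∷ []) ⊢ₚ (P ∷ [])
  ∧L   : ∀ {Γ Δ P Q} → (P ∷ Q ∷ Γ) ⊢ₚ Δ → ((P ∧ₚ Q) ∷ Γ) ⊢ₚ Δ
  ∧R   : ∀ {Γ Δ P Q} → Γ ⊢ₚ (P ∷ Δ) → Γ ⊢ₚ (Q ∷ Δ) → Γ ⊢ₚ ((P ∧ₚ Q) ∷ Δ)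
  ∨L   : ∀ {Γ Δ P Q} → (P ∷ Γ) ⊢ₚ Δ → (Q ∷ Γ) ⊢ₚ Δ → ((P ∨ₚ Q) ∷ Γ) ⊢ₚ Δ
  ∨R   : ∀ {Γ Δ P Q} → Γ ⊢ₚ (P ∷ Q ∷ Δ) → Γ ⊢ₚ ((P ∨ₚ Q) ∷ Δ)
  ¬L   : ∀ {Γ Δ P} → Γ ⊢ₚ (P ∷ Δ) → (¬ₚ P ∷ Γ) ⊢ₚ Δ
  ¬R   : ∀ {Γ Δ P} → (P ∷ Γ) ⊢ₚ Δ → Γ ⊢ₚ (¬ₚ P ∷ Δ)
  Cut  : ∀ {Γ Δ P} → Γ ⊢ₚ (P ∷ Δ) → (P ∷ Γ) ⊢ₚ Δ → Γ ⊢ₚ Δ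
  WL   : ∀ {Γ Δ P} → Γ ⊢ₚ Δ → (P ∷ Γ) ⊢ₚ Δ
  WR   : ∀ {Γ Δ P} → Γ ⊢ₚ Δ → Γ ⊢ₚ (P ∷ Δ)
  CL   : ∀ {Γ Δ P} → (P ∷ P ∷ Γ) ⊢ₚ Δ → (P ∷ Γ) ⊢ₚ Δ
  CR   : ∀ {Γ Δ P} → Γ ⊢ₚ (P ∷ P ∷ Δ) → Γ ⊢ₚ (P ∷ Δ)
  ExL  : ∀ {Γ Γ' Δ} → Γ ↭ Γ' → Γ ⊢ₚ Δ → Γ' ⊢ₚ Δ
  ExR  : ∀ {Γ Δ Δ'} → Δ ↭ Δ' → Γ ⊢ₚ Δ → Γ ⊢ₚ Δ'

_° : PFm → Fm
𝟘 ° = e two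
𝟙 ° = e one
pv X ° = var X pid
¬ₚ P ° = (P °) ^ swp
(P ∧ₚ Q) ° = q (P °) (Q °) (e two)
(P ∨ₚ Q) ° = q (P °) (e one) (Q °)

_• : Fm → PFm
e two • = 𝟘
e one • = 𝟙
var X pid • = pv X
var X swp • = ¬ₚ (pv X)
q F G H • = ((F •) ∧ₚ (G •)) ∨ₚ (¬ₚ (F •) ∧ₚ (H •))

_°ˢ : List PFm → List Fm
Γ °ˢ = map _° Γ

_•ˢ : List Fm → List PFm
Γ •ˢ = map _• Γ

-- Both calculi are sound and complete for their semantics, so (2) follows
-- from (1).  For (1), a 2PC valuation v and the Boolean valuation "v X = 1"
-- give F and F• (and P° and P) the same truth value, because F^(12) is the
-- negation of F and q(F,G,H) is the case distinction (F ∧ G) ∨ (¬F ∧ H).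
--
-- Completeness is backward proof search with semantically invertible rules,
-- made structural by decomposing one formula at a time and collecting the
-- atoms it produces at the end of both sides: a sequent is complete as soon
-- as all its extensions by atoms are.  At index 1 the negation rules say that
-- F^(12) holds exactly when F fails, which turns the q-rules into the PC
-- rules for (F ∧ G₁) ∨ (¬F ∧ G₂).
module Submission where

open import Defs
open import Data.List using (List)
open import Data.Product using (_×_)
open import Function.Bundles using (_⇔_)

open import Data.Bool using (Bool; true; false; not; _∧_; _∨_)
open import Data.Bool.Properties using (∧-conicalˡ; ∧-conicalʳ; not-¬)
open import Data.Empty using (⊥-elim)
open import Data.List using ([]; _∷_; _++_; map)
open import Data.List.Properties using (++-identityʳ)
open import Data.List.Membership.Propositional using (_∈_; find)
open import Data.List.Membership.Propositional.Properties using (∈-map⁺)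
open import Data.Nat using (ℕ) renaming (_≟_ to _≟ℕ_)
open import Data.List.Membership.DecPropositional _≟ℕ_ using (_∈?_)
open import Data.List.Relation.Binary.Pointwise using (Pointwise; []; _∷_)
open import Data.List.Relation.Binary.Permutation.Propositional using (↭-refl; ↭-sym; swap)
open import Data.List.Relation.Binary.Permutation.Propositional.Properties
  using (shift; ++-comm; All-resp-↭; Any-resp-↭)
open import Data.List.Relation.Unary.All as All using (All; []; _∷_)
open import Data.List.Relation.Unary.Any as Any using (Any; here; there)
import Data.List.Relation.Unary.All.Properties as Allₚ
import Data.List.Relation.Unary.Any.Properties as Anyₚ
open import Data.Product using (_,_)
open import Data.Sum using (_⊎_; inj₁; inj₂; [_,_]′)
open import Function using (_∘_)
open import Function.Bundles using (mk⇔; Equivalence)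
open import Function.Properties.Equivalence using () renaming (sym to ⇔-sym; trans to ⇔-trans)
open import Relation.Binary.PropositionalEquality using (_≡_; refl; sym; trans; cong; cong₂; subst; subst₂)
open import Relation.Nullary using (¬_; Dec; yes; no; does)
open import Relation.Nullary.Decidable using (dec-true)

open Equivalence using (to; from)

Any-head : ∀ {A : Set} {P : A → Set} {x y xs} → (P x → P y) → Any P (x ∷ xs) → Any P (y ∷ xs)
Any-head f (here p) = here (f p)
Any-head f (there h) = there h

_≟₂_ : (x y : Two) → Dec (x ≡ y)
one ≟₂ one = yes refl
one ≟₂ two = no λ ()
two ≟₂ one = no λ ()
two ≟₂ two = yes refl

Two-cases : (x : Two) → x ≡ one ⊎ x ≡ two
Two-cases one = inj₁ refl
Two-cases two = inj₂ refl

toBool : Two → Bool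
toBool one = true
toBool two = false

fromBool : Bool → Two
fromBool true = one
fromBool false = two

toBool-fromBool : ∀ b → toBool (fromBool b) ≡ b
toBool-fromBool true = refl
toBool-fromBool false = refl

toBool-true : ∀ {x} → toBool x ≡ true → x ≡ one
toBool-true {one} _ = refl

toBool-swp : ∀ x → toBool (act swp x) ≡ not (toBool x)
toBool-swp one = refl
toBool-swp two = refl

act-∘ : ∀ ρ π x → act (ρ ∘ₚ π) x ≡ act ρ (act π x)
act-∘ pid π x = refl
act-∘ swp pid x = refl
act-∘ swp swp one = refl
act-∘ swp swp two = refl

act-involutive : ∀ ρ x → act ρ (act ρ x) ≡ x
act-involutive pid x = refl
act-involutive swp one = refl
act-involutive swp two = refl

∘ₚ-involutive : ∀ ρ π → ρ ∘ₚ (ρ ∘ₚ π) ≡ π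
∘ₚ-involutive pid π = refl
∘ₚ-involutive swp pid = refl
∘ₚ-involutive swp swp = refl

act-pick : ∀ ρ k x y → pick k (act ρ x) (act ρ y) ≡ act ρ (pick k x y)
act-pick ρ one x y = refl
act-pick ρ two x y = refl

tr-mapsˡ : ∀ i j → act (tr i j) i ≡ j
tr-mapsˡ one one = refl
tr-mapsˡ one two = refl
tr-mapsˡ two one = refl
tr-mapsˡ two two = refl

tr-mapsʳ : ∀ i j → act (tr i j) j ≡ i
tr-mapsʳ one one = refl
tr-mapsʳ one two = refl
tr-mapsʳ two one = refl
tr-mapsʳ two two = refl

tr-preimage : ∀ i j x → act (tr i j) x ≡ i → x ≡ j
tr-preimage i j x p =
  trans (sym (act-involutive (tr i j) x)) (trans (cong (act (tr i j)) p) (tr-mapsˡ i j))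

^-identity : ∀ F → F ^ pid ≡ F
^-identity (var X π) = refl
^-identity (e k) = refl
^-identity (q F G₁ G₂) = cong₂ (q F) (^-identity G₁) (^-identity G₂)

^ˢ-identity : ∀ Γ → Γ ^ˢ pid ≡ Γ
^ˢ-identity [] = refl
^ˢ-identity (F ∷ Γ) = cong₂ _∷_ (^-identity F) (^ˢ-identity Γ)

^-involutive : ∀ ρ F → (F ^ ρ) ^ ρ ≡ F
^-involutive ρ (var X π) = cong (var X) (∘ₚ-involutive ρ π)
^-involutive ρ (e k) = cong e (act-involutive ρ k)
^-involutive ρ (q F G₁ G₂) = cong₂ (q F) (^-involutive ρ G₁) (^-involutive ρ G₂)

^ˢ-involutive : ∀ ρ Γ → (Γ ^ˢ ρ) ^ˢ ρ ≡ Γ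
^ˢ-involutive ρ [] = refl
^ˢ-involutive ρ (F ∷ Γ) = cong₂ _∷_ (^-involutive ρ F) (^ˢ-involutive ρ Γ)

-- Semantics and soundness of 2PC

⟦^⟧ : ∀ F ρ v → ⟦ F ^ ρ ⟧ v ≡ act ρ (⟦ F ⟧ v)
⟦^⟧ (var X π) ρ v = act-∘ ρ π (v X)
⟦^⟧ (e k) ρ v = refl
⟦^⟧ (q F G₁ G₂) ρ v rewrite ⟦^⟧ G₁ ρ v | ⟦^⟧ G₂ ρ v = act-pick ρ (⟦ F ⟧ v) _ _

⟦pick⟧ : ∀ k G₁ G₂ v → ⟦ pick k G₁ G₂ ⟧ v ≡ pick k (⟦ G₁ ⟧ v) (⟦ G₂ ⟧ v)
⟦pick⟧ one G₁ G₂ v = refl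
⟦pick⟧ two G₁ G₂ v = refl

⟦q⟧-selects : ∀ F G₁ G₂ {v k} → ⟦ F ⟧ v ≡ k → ⟦ q F G₁ G₂ ⟧ v ≡ ⟦ pick k G₁ G₂ ⟧ v
⟦q⟧-selects F G₁ G₂ {v} {k} p =
  trans (cong (λ x → pick x (⟦ G₁ ⟧ v) (⟦ G₂ ⟧ v)) p) (sym (⟦pick⟧ k G₁ G₂ v))

module _ {v : ℕ → Two} (i j : Two) where

  relabel : ∀ F → ⟦ F ⟧ v ≡ j → ⟦ F ^ tr i j ⟧ v ≡ i
  relabel F p = trans (⟦^⟧ F (tr i j) v) (trans (cong (act (tr i j)) p) (tr-mapsʳ i j))

  unrelabel : ∀ F → ⟦ F ^ tr i j ⟧ v ≡ i → ⟦ F ⟧ v ≡ j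
  unrelabel F p = tr-preimage i j _ (trans (sym (⟦^⟧ F (tr i j) v)) p)

  All-relabel : ∀ {Γ} → All (λ F → ⟦ F ⟧ v ≡ j) Γ → All (λ F → ⟦ F ⟧ v ≡ i) (Γ ^ˢ tr i j)
  All-relabel = Allₚ.map⁺ ∘ All.map (λ {F} → relabel F)

  Any-unrelabel : ∀ {Δ} → Any (λ F → ⟦ F ⟧ v ≡ i) (Δ ^ˢ tr i j) → Any (λ F → ⟦ F ⟧ v ≡ j) Δ
  Any-unrelabel = Any.map (λ {F} → unrelabel F) ∘ Anyₚ.map⁻

_⊨[_]_ : List Fm → Two → List Fm → Set
Γ ⊨[ i ] Δ = ∀ v → All (λ F → ⟦ F ⟧ v ≡ i) Γ → Any (λ F → ⟦ F ⟧ v ≡ i) Δ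

-- In S₂ every permutation is its own inverse, so the side condition of (Id) says π = ρ.
Id-sound : ∀ π ρ {i x} → act (inv π) i ≡ act (inv ρ) i → act π x ≡ i → act ρ x ≡ i
Id-sound pid pid _ p = p
Id-sound swp swp _ p = p
Id-sound pid swp {one} () _
Id-sound pid swp {two} () _
Id-sound swp pid {one} () _
Id-sound swp pid {two} () _

sound : ∀ {i Γ Δ} → Γ ⊢[ i ] Δ → Γ ⊨[ i ] Δ
sound Const v _ = here refl
sound (Id {π = π} {ρ} eq) v (p ∷ []) = here (Id-sound π ρ eq p)
sound (Sym {i} {j} d) v s = Any-unrelabel i j (sound d v (All-relabel i j s))
sound (Neg1 {i} {j} {k} {F = F} i≢k d) v (f ∷ s) with sound d v (All-relabel i j s)
... | here F≡i = ⊥-elim (i≢k (trans (sym F≡i) (unrelabel j k F f)))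
... | there h = Any-unrelabel i j h
sound (Neg2 {i} {j} {k} {F = F} j≢k d) v (f ∷ s) with sound d v (All-relabel i j s)
... | here F≡i =
  ⊥-elim (j≢k (trans (sym f) (trans (⟦^⟧ F (tr i k) v) (trans (cong (act (tr i k)) F≡i) (tr-mapsˡ i k)))))
... | there h = Any-unrelabel i j h
sound (Neg3 {j} {F = F} h) v s with ⟦ F ⟧ v ≟₂ j
... | yes F≡j = here F≡j
... | no F≢j = there (Any-unrelabel _ j (sound (h _ F≢j) v (refl ∷ All-relabel _ j s)))
sound (qL {i} {F = F} {G₁} {G₂} h) v (p ∷ s) =
  Any-unrelabel k i (sound (h k) v (relabel k i (pick k G₁ G₂) (trans (sym (⟦q⟧-selects F G₁ G₂ refl)) p)
                                    ∷ refl ∷ All-relabel k i s))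
  where k = ⟦ F ⟧ v
sound (qR {i} {F = F} {G₁} {G₂} h) v s with sound (h (⟦ F ⟧ v)) v (refl ∷ All-relabel _ i s)
... | here g = here (trans (⟦q⟧-selects F G₁ G₂ refl) (unrelabel _ i (pick (⟦ F ⟧ v) G₁ G₂) g))
... | there h = there (Any-unrelabel _ i h)
sound (Cut {i} {F = F} d₁ d₂) v s with ⟦ F ⟧ v ≟₂ i
... | yes F≡i = sound d₂ v (F≡i ∷ s)
... | no F≢i = Any.tail F≢i (sound d₁ v s)
sound (WL d) v (_ ∷ s) = sound d v s
sound (WR d) v s = there (sound d v s)
sound (CL d) v (p ∷ s) = sound d v (p ∷ p ∷ s)
sound (CR d) v s with sound d v s
... | here p = here p
... | there h = h
sound (ExL p d) v s = sound d v (All-resp-↭ (↭-sym p) s)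
sound (ExR p d) v s = Any-resp-↭ p (sound d v s)

_⊢₁_ : List Fm → List Fm → Set
Γ ⊢₁ Δ = Γ ⊢[ one ] Δ

⊢-weaken : ∀ {i Γ Δ Γ' Δ'} → Γ ⊢[ i ] Δ → (Γ ++ Γ') ⊢[ i ] (Δ ++ Δ')
⊢-weaken {Γ = Γ} {Δ} {Γ'} {Δ'} d = ExL (++-comm Γ' Γ) (ExR (++-comm Δ' Δ) (weaken-front Γ' Δ'))
  where
  weaken-front : ∀ Γ'' Δ'' → (Γ'' ++ Γ) ⊢[ _ ] (Δ'' ++ Δ)
  weaken-front [] [] = d
  weaken-front (_ ∷ Γ'') Δ'' = WL (weaken-front Γ'' Δ'')
  weaken-front [] (_ ∷ Δ'') = WR (weaken-front [] Δ'')

∈-Id : ∀ {i X π Γ Δ} → var X π ∈ Γ → var X π ∈ Δ → Γ ⊢[ i ] Δ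
∈-Id (there p) h = WL (∈-Id p h)
∈-Id (here refl) (there h) = WR (∈-Id (here refl) h)
∈-Id (here refl) (here refl) = ⊢-weaken (Id refl)

e₂L₁ : (e two ∷ []) ⊢₁ []
e₂L₁ = Neg1 {i = two} {k = one} (λ ()) Const

to-index₂ : ∀ {Γ Δ} → Γ ⊢₁ Δ → (Γ ^ˢ swp) ⊢[ two ] (Δ ^ˢ swp)
to-index₂ {Γ} {Δ} d = Sym {i = one} (subst₂ _⊢₁_ (sym (^ˢ-involutive swp Γ)) (sym (^ˢ-involutive swp Δ)) d)

negL₁ : ∀ {Γ Δ F} → Γ ⊢₁ (F ∷ Δ) → ((F ^ swp) ∷ Γ) ⊢₁ Δ
negL₁ {Γ} {Δ} {F} d =
  Neg1 {i = one} {k = two} (λ ())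
    (subst₂ (λ Γ' Δ' → Γ' ⊢₁ (F ∷ Δ')) (sym (^ˢ-identity Γ)) (sym (^ˢ-identity Δ)) d)

negR₁ : ∀ {Γ Δ F} → (F ∷ Γ) ⊢₁ Δ → Γ ⊢₁ ((F ^ swp) ∷ Δ)
negR₁ {Γ} {Δ} {F} d = Neg3 premise
  where
  premise : ∀ i → ¬ i ≡ one → ((F ^ swp) ∷ (Γ ^ˢ tr i one)) ⊢[ i ] (Δ ^ˢ tr i one)
  premise one 1≢1 = ⊥-elim (1≢1 refl)
  premise two _ = to-index₂ d

qL₁ : ∀ {Γ Δ F G₁ G₂} → (G₁ ∷ F ∷ Γ) ⊢₁ Δ → (G₂ ∷ (F ^ swp) ∷ Γ) ⊢₁ Δ → (q F G₁ G₂ ∷ Γ) ⊢₁ Δ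
qL₁ {Γ} {Δ} {F} {G₁} {G₂} d₁ d₂ = qL premise
  where
  premise : ∀ j → ((pick j G₁ G₂ ^ tr j one) ∷ F ∷ (Γ ^ˢ tr j one)) ⊢[ j ] (Δ ^ˢ tr j one)
  premise one =
    subst₂ _⊢₁_ (sym (cong₂ (λ G Γ' → G ∷ F ∷ Γ') (^-identity G₁) (^ˢ-identity Γ))) (sym (^ˢ-identity Δ)) d₁
  premise two =
    subst (λ H → ((G₂ ^ swp) ∷ H ∷ (Γ ^ˢ swp)) ⊢[ two ] (Δ ^ˢ swp)) (^-involutive swp F) (to-index₂ d₂)

qR₁ : ∀ {Γ Δ F G₁ G₂} → (F ∷ Γ) ⊢₁ (G₁ ∷ Δ) → ((F ^ swp) ∷ Γ) ⊢₁ (G₂ ∷ Δ) → Γ ⊢₁ (q F G₁ G₂ ∷ Δ)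
qR₁ {Γ} {Δ} {F} {G₁} {G₂} d₁ d₂ = qR premise
  where
  premise : ∀ j → (F ∷ (Γ ^ˢ tr j one)) ⊢[ j ] ((pick j G₁ G₂ ^ tr j one) ∷ (Δ ^ˢ tr j one))
  premise one =
    subst₂ _⊢₁_ (sym (cong (F ∷_) (^ˢ-identity Γ))) (sym (cong₂ _∷_ (^-identity G₁) (^ˢ-identity Δ))) d₁
  premise two =
    subst (λ H → (H ∷ (Γ ^ˢ swp)) ⊢[ two ] ((G₂ ^ swp) ∷ (Δ ^ˢ swp))) (^-involutive swp F) (to-index₂ d₂)

-- Completeness of 2PC at index 1

module AtomExtensions {A : Set} (atom : ℕ → A) (_⊨ₓ_ _⊢ₓ_ : List A → List A → Set) where

  Complete : List A → List A → Set
  Complete Γ Δ = Γ ⊨ₓ Δ → Γ ⊢ₓ Δ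

  CompleteWithAtoms : List A → List A → Set
  CompleteWithAtoms Γ Δ = ∀ As Bs → Complete (Γ ++ map atom As) (Δ ++ map atom Bs)

  complete-without-atoms : ∀ {Γ Δ} → CompleteWithAtoms Γ Δ → Complete Γ Δ
  complete-without-atoms {Γ} {Δ} c = subst₂ Complete (++-identityʳ Γ) (++-identityʳ Δ) (c [] [])

does-true : ∀ {A : Set} (a? : Dec A) → does a? ≡ true → A
does-true (yes a) _ = a

fromBool-does : ∀ {A : Set} (a? : Dec A) → fromBool (does a?) ≡ one → A
fromBool-does (yes a) _ = a

module Completeness₁ where

  open AtomExtensions (λ X → var X pid) _⊨₁_ _⊢₁_

  vars : List ℕ → List Fm
  vars = map (λ X → var X pid)

  -- The countermodel makes exactly the atoms of the antecedent true.
  atomic : ∀ As Bs → Complete (vars As) (vars Bs)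
  atomic As Bs V =
    let X , X∈Bs , X-true = find (Anyₚ.map⁻ (V v (Allₚ.map⁺ (All.tabulate true-on))))
    in ∈-Id (∈-map⁺ _ (fromBool-does (X ∈? As) X-true)) (∈-map⁺ _ X∈Bs)
    where
    v : ℕ → Two
    v X = fromBool (does (X ∈? As))
    true-on : ∀ {X} → X ∈ As → v X ≡ one
    true-on {X} X∈As = cong fromBool (dec-true (X ∈? As) X∈As)

  shiftˡ : ∀ {F Γ' Δ} Γ → Complete (Γ ++ F ∷ Γ') Δ → Complete (F ∷ Γ ++ Γ') Δ
  shiftˡ {F} {Γ'} Γ c V = ExL (shift F Γ Γ') (c λ v s → V v (All-resp-↭ (shift F Γ Γ') s))

  shiftʳ : ∀ {F Γ Δ'} Δ → Complete Γ (Δ ++ F ∷ Δ') → Complete Γ (F ∷ Δ ++ Δ')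
  shiftʳ {F} {Δ' = Δ'} Δ c V = ExR (shift F Δ Δ') (c λ v s → Any-resp-↭ (↭-sym (shift F Δ Δ')) (V v s))

  e₁ˡ : ∀ {Γ Δ} → Complete Γ Δ → Complete (e one ∷ Γ) Δ
  e₁ˡ c V = WL (c λ v s → V v (refl ∷ s))

  e₂ˡ : ∀ {Γ Δ} → Complete (e two ∷ Γ) Δ
  e₂ˡ _ = ⊢-weaken e₂L₁

  e₁ʳ : ∀ {Γ Δ} → Complete Γ (e one ∷ Δ)
  e₁ʳ _ = ⊢-weaken {Γ = []} Const

  e₂ʳ : ∀ {Γ Δ} → Complete Γ Δ → Complete Γ (e two ∷ Δ)
  e₂ʳ c V = WR (c λ v s → Any.tail (λ ()) (V v s))

  negˡ : ∀ {F Γ Δ} → Complete Γ (F ∷ Δ) → Complete ((F ^ swp) ∷ Γ) Δ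
  negˡ {F} c V = negL₁ (c λ v s →
    [ here , (λ F≡2 → there (V v (relabel one two F F≡2 ∷ s))) ]′ (Two-cases (⟦ F ⟧ v)))

  negʳ : ∀ {F Γ Δ} → Complete (F ∷ Γ) Δ → Complete Γ ((F ^ swp) ∷ Δ)
  negʳ {F} {Γ} {Δ} c V = negR₁ (c V′)
    where
    V′ : (F ∷ Γ) ⊨₁ Δ
    V′ v (F≡1 ∷ s) = Any.tail F^swp≢1 (V v s)
      where
      F^swp≢1 : ¬ ⟦ F ^ swp ⟧ v ≡ one
      F^swp≢1 p with trans (sym F≡1) (unrelabel one two F p)
      ... | ()

  qˡ : ∀ {F G₁ G₂ Γ Δ} → Complete (F ∷ G₁ ∷ Γ) Δ → Complete (G₂ ∷ Γ) (F ∷ Δ) →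
       Complete (q F G₁ G₂ ∷ Γ) Δ
  qˡ {F} {G₁} {G₂} {Γ} {Δ} c₁ c₂ V =
    qL₁ (ExL (swap F G₁ ↭-refl) (c₁ V₁)) (ExL (swap (F ^ swp) G₂ ↭-refl) (negL₁ (c₂ V₂)))
    where
    V₁ : (F ∷ G₁ ∷ Γ) ⊨₁ Δ
    V₁ v (F≡1 ∷ G₁≡1 ∷ s) = V v (trans (⟦q⟧-selects F G₁ G₂ F≡1) G₁≡1 ∷ s)
    V₂ : (G₂ ∷ Γ) ⊨₁ (F ∷ Δ)
    V₂ v (G₂≡1 ∷ s) with Two-cases (⟦ F ⟧ v)
    ... | inj₁ F≡1 = here F≡1
    ... | inj₂ F≡2 = there (V v (trans (⟦q⟧-selects F G₁ G₂ F≡2) G₂≡1 ∷ s))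

  qʳ : ∀ {F G₁ G₂ Γ Δ} → Complete (F ∷ Γ) (G₁ ∷ Δ) → Complete Γ (F ∷ G₂ ∷ Δ) →
       Complete Γ (q F G₁ G₂ ∷ Δ)
  qʳ {F} {G₁} {G₂} {Γ} {Δ} c₁ c₂ V = qR₁ (c₁ V₁) (negL₁ (c₂ V₂))
    where
    V₁ : (F ∷ Γ) ⊨₁ (G₁ ∷ Δ)
    V₁ v (F≡1 ∷ s) = Any-head (trans (sym (⟦q⟧-selects F G₁ G₂ F≡1))) (V v s)
    V₂ : Γ ⊨₁ (F ∷ G₂ ∷ Δ)
    V₂ v s with Two-cases (⟦ F ⟧ v)
    ... | inj₁ F≡1 = here F≡1
    ... | inj₂ F≡2 = there (Any-head (trans (sym (⟦q⟧-selects F G₁ G₂ F≡2))) (V v s))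

  left  : ∀ F {Γ Δ} → CompleteWithAtoms Γ Δ → CompleteWithAtoms (F ∷ Γ) Δ
  right : ∀ F {Γ Δ} → CompleteWithAtoms Γ Δ → CompleteWithAtoms Γ (F ∷ Δ)

  left (var X pid) {Γ} c As Bs = shiftˡ Γ (c (X ∷ As) Bs)
  left (var X swp) {Δ = Δ} c As Bs = negˡ {var X pid} (shiftʳ Δ (c As (X ∷ Bs)))
  left (e one) c As Bs = e₁ˡ (c As Bs)
  left (e two) c As Bs = e₂ˡ
  left (q F G₁ G₂) c As Bs = qˡ (left F (left G₁ c) As Bs) (left G₂ (right F c) As Bs)

  right (var X pid) {Δ = Δ} c As Bs = shiftʳ Δ (c As (X ∷ Bs))
  right (var X swp) {Γ} c As Bs = negʳ {var X pid} (shiftˡ Γ (c (X ∷ As) Bs))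
  right (e one) c As Bs = e₁ʳ
  right (e two) c As Bs = e₂ʳ (c As Bs)
  right (q F G₁ G₂) c As Bs = qʳ (left F (right G₁ c) As Bs) (right F (right G₂ c) As Bs)

  complete-with-atoms : ∀ Γ Δ → CompleteWithAtoms Γ Δ
  complete-with-atoms [] [] = atomic
  complete-with-atoms [] (F ∷ Δ) = right F (complete-with-atoms [] Δ)
  complete-with-atoms (F ∷ Γ) Δ = left F (complete-with-atoms Γ Δ)

  complete₁ : ∀ {Γ Δ} → Γ ⊨₁ Δ → Γ ⊢₁ Δ
  complete₁ = complete-without-atoms (complete-with-atoms _ _)

open Completeness₁ using (complete₁)

-- Soundness and completeness of PC

∧-intro : ∀ {a b} → a ≡ true → b ≡ true → a ∧ b ≡ true
∧-intro refl refl = refl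

∨-introˡ : ∀ {a b} → a ≡ true → a ∨ b ≡ true
∨-introˡ refl = refl

∨-introʳ : ∀ {a b} → b ≡ true → a ∨ b ≡ true
∨-introʳ {true} _ = refl
∨-introʳ {false} p = p

∨-elim : ∀ {a b} → a ∨ b ≡ true → a ≡ true ⊎ b ≡ true
∨-elim {true} _ = inj₁ refl
∨-elim {false} p = inj₂ p

Bool-cases : (b : Bool) → b ≡ true ⊎ b ≡ false
Bool-cases true = inj₁ refl
Bool-cases false = inj₂ refl

soundₚ : ∀ {Γ Δ} → Γ ⊢ₚ Δ → Γ ⊨ Δ
soundₚ ⊢𝟙 w _ = here refl
soundₚ 𝟘⊢ w (() ∷ [])
soundₚ ax w (p ∷ []) = here p
soundₚ (∧L d) w (p ∷ s) = soundₚ d w (∧-conicalˡ _ _ p ∷ ∧-conicalʳ _ _ p ∷ s)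
soundₚ (∧R d₁ d₂) w s with soundₚ d₁ w s | soundₚ d₂ w s
... | here a | here b = here (∧-intro a b)
... | there h | _ = there h
... | here _ | there h = there h
soundₚ (∨L d₁ d₂) w (p ∷ s) = [ (λ a → soundₚ d₁ w (a ∷ s)) , (λ b → soundₚ d₂ w (b ∷ s)) ]′ (∨-elim p)
soundₚ (∨R d) w s with soundₚ d w s
... | here a = here (∨-introˡ a)
... | there (here b) = here (∨-introʳ b)
... | there (there h) = there h
soundₚ (¬L d) w (p ∷ s) = Any.tail (λ t → not-¬ (cong not t) p) (soundₚ d w s)
soundₚ (¬R {P = P} d) w s =
  [ (λ t → there (soundₚ d w (t ∷ s))) , (λ f → here (cong not f)) ]′ (Bool-cases (evalₚ w P))
soundₚ (Cut {P = P} d₁ d₂) w s =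
  [ (λ t → soundₚ d₂ w (t ∷ s)) , (λ f → Any.tail (not-¬ f) (soundₚ d₁ w s)) ]′ (Bool-cases (evalₚ w P))
soundₚ (WL d) w (_ ∷ s) = soundₚ d w s
soundₚ (WR d) w s = there (soundₚ d w s)
soundₚ (CL d) w (p ∷ s) = soundₚ d w (p ∷ p ∷ s)
soundₚ (CR d) w s with soundₚ d w s
... | here p = here p
... | there h = h
soundₚ (ExL p d) w s = soundₚ d w (All-resp-↭ (↭-sym p) s)
soundₚ (ExR p d) w s = Any-resp-↭ p (soundₚ d w s)

⊢ₚ-weaken : ∀ {Γ Δ Γ' Δ'} → Γ ⊢ₚ Δ → (Γ ++ Γ') ⊢ₚ (Δ ++ Δ')
⊢ₚ-weaken {Γ} {Δ} {Γ'} {Δ'} d = ExL (++-comm Γ' Γ) (ExR (++-comm Δ' Δ) (weaken-front Γ' Δ'))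
  where
  weaken-front : ∀ Γ'' Δ'' → (Γ'' ++ Γ) ⊢ₚ (Δ'' ++ Δ)
  weaken-front [] [] = d
  weaken-front (_ ∷ Γ'') Δ'' = WL (weaken-front Γ'' Δ'')
  weaken-front [] (_ ∷ Δ'') = WR (weaken-front [] Δ'')

∈-ax : ∀ {P Γ Δ} → P ∈ Γ → P ∈ Δ → Γ ⊢ₚ Δ
∈-ax (there p) h = WL (∈-ax p h)
∈-ax (here refl) (there h) = WR (∈-ax (here refl) h)
∈-ax (here refl) (here refl) = ⊢ₚ-weaken ax

module Completenessₚ where

  open AtomExtensions pv _⊨_ _⊢ₚ_

  atomic : ∀ As Bs → Complete (map pv As) (map pv Bs)
  atomic As Bs V =
    let X , X∈Bs , X-true = find (Anyₚ.map⁻ (V w (Allₚ.map⁺ (All.tabulate (dec-true (_ ∈? As))))))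
    in ∈-ax (∈-map⁺ _ (does-true (X ∈? As) X-true)) (∈-map⁺ _ X∈Bs)
    where
    w : ℕ → Bool
    w X = does (X ∈? As)

  shiftˡ : ∀ {P Γ' Δ} Γ → Complete (Γ ++ P ∷ Γ') Δ → Complete (P ∷ Γ ++ Γ') Δ
  shiftˡ {P} {Γ'} Γ c V = ExL (shift P Γ Γ') (c λ w s → V w (All-resp-↭ (shift P Γ Γ') s))

  shiftʳ : ∀ {P Γ Δ'} Δ → Complete Γ (Δ ++ P ∷ Δ') → Complete Γ (P ∷ Δ ++ Δ')
  shiftʳ {P} {Δ' = Δ'} Δ c V = ExR (shift P Δ Δ') (c λ w s → Any-resp-↭ (↭-sym (shift P Δ Δ')) (V w s))

  𝟘ˡ : ∀ {Γ Δ} → Complete (𝟘 ∷ Γ) Δ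
  𝟘ˡ _ = ⊢ₚ-weaken 𝟘⊢

  𝟙ˡ : ∀ {Γ Δ} → Complete Γ Δ → Complete (𝟙 ∷ Γ) Δ
  𝟙ˡ c V = WL (c λ w s → V w (refl ∷ s))

  𝟘ʳ : ∀ {Γ Δ} → Complete Γ Δ → Complete Γ (𝟘 ∷ Δ)
  𝟘ʳ c V = WR (c λ w s → Any.tail (λ ()) (V w s))

  𝟙ʳ : ∀ {Γ Δ} → Complete Γ (𝟙 ∷ Δ)
  𝟙ʳ _ = ⊢ₚ-weaken {Γ = []} ⊢𝟙

  ¬ˡ : ∀ {P Γ Δ} → Complete Γ (P ∷ Δ) → Complete (¬ₚ P ∷ Γ) Δ
  ¬ˡ {P} c V = ¬L (c λ w s →
    [ here , (λ f → there (V w (cong not f ∷ s))) ]′ (Bool-cases (evalₚ w P)))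

  ¬ʳ : ∀ {P Γ Δ} → Complete (P ∷ Γ) Δ → Complete Γ (¬ₚ P ∷ Δ)
  ¬ʳ c V = ¬R (c λ { w (t ∷ s) → Any.tail (not-¬ (cong not t)) (V w s) })

  ∧ˡ : ∀ {P Q Γ Δ} → Complete (P ∷ Q ∷ Γ) Δ → Complete ((P ∧ₚ Q) ∷ Γ) Δ
  ∧ˡ c V = ∧L (c λ { w (a ∷ b ∷ s) → V w (∧-intro a b ∷ s) })

  ∧ʳ : ∀ {P Q Γ Δ} → Complete Γ (P ∷ Δ) → Complete Γ (Q ∷ Δ) → Complete Γ ((P ∧ₚ Q) ∷ Δ)
  ∧ʳ c₁ c₂ V = ∧R (c₁ λ w s → Any-head (∧-conicalˡ _ _) (V w s)) (c₂ λ w s → Any-head (∧-conicalʳ _ _) (V w s))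

  ∨ˡ : ∀ {P Q Γ Δ} → Complete (P ∷ Γ) Δ → Complete (Q ∷ Γ) Δ → Complete ((P ∨ₚ Q) ∷ Γ) Δ
  ∨ˡ c₁ c₂ V = ∨L (c₁ λ { w (a ∷ s) → V w (∨-introˡ a ∷ s) }) (c₂ λ { w (b ∷ s) → V w (∨-introʳ b ∷ s) })

  ∨ʳ : ∀ {P Q Γ Δ} → Complete Γ (P ∷ Q ∷ Δ) → Complete Γ ((P ∨ₚ Q) ∷ Δ)
  ∨ʳ c V = ∨R (c λ w s → split (V w s))
    where
    split : ∀ {w P Q Δ} → Any (λ R → evalₚ w R ≡ true) ((P ∨ₚ Q) ∷ Δ) → Any (λ R → evalₚ w R ≡ true) (P ∷ Q ∷ Δ)
    split (here p∨q) = [ here , there ∘ here ]′ (∨-elim p∨q)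
    split (there h) = there (there h)

  left  : ∀ P {Γ Δ} → CompleteWithAtoms Γ Δ → CompleteWithAtoms (P ∷ Γ) Δ
  right : ∀ P {Γ Δ} → CompleteWithAtoms Γ Δ → CompleteWithAtoms Γ (P ∷ Δ)

  left 𝟘 c As Bs = 𝟘ˡ
  left 𝟙 c As Bs = 𝟙ˡ (c As Bs)
  left (pv X) {Γ} c As Bs = shiftˡ Γ (c (X ∷ As) Bs)
  left (¬ₚ P) c As Bs = ¬ˡ (right P c As Bs)
  left (P ∧ₚ Q) c As Bs = ∧ˡ (left P (left Q c) As Bs)
  left (P ∨ₚ Q) c As Bs = ∨ˡ (left P c As Bs) (left Q c As Bs)

  right 𝟘 c As Bs = 𝟘ʳ (c As Bs)
  right 𝟙 c As Bs = 𝟙ʳ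
  right (pv X) {Δ = Δ} c As Bs = shiftʳ Δ (c As (X ∷ Bs))
  right (¬ₚ P) c As Bs = ¬ʳ (left P c As Bs)
  right (P ∧ₚ Q) c As Bs = ∧ʳ (right P c As Bs) (right Q c As Bs)
  right (P ∨ₚ Q) c As Bs = ∨ʳ (right P (right Q c) As Bs)

  complete-with-atoms : ∀ Γ Δ → CompleteWithAtoms Γ Δ
  complete-with-atoms [] [] = atomic
  complete-with-atoms [] (P ∷ Δ) = right P (complete-with-atoms [] Δ)
  complete-with-atoms (P ∷ Γ) Δ = left P (complete-with-atoms Γ Δ)

  completeₚ : ∀ {Γ Δ} → Γ ⊨ Δ → Γ ⊢ₚ Δ
  completeₚ = complete-without-atoms (complete-with-atoms _ _)

open Completenessₚ using (completeₚ)

-- The translations preserve truth values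

toBool-pick : ∀ x y z → toBool (pick x y z) ≡ (toBool x ∧ toBool y) ∨ (not (toBool x) ∧ toBool z)
toBool-pick one one z = refl
toBool-pick one two z = refl
toBool-pick two y z = refl

toBool-pick-∧ : ∀ x y → toBool (pick x y two) ≡ toBool x ∧ toBool y
toBool-pick-∧ one y = refl
toBool-pick-∧ two y = refl

toBool-pick-∨ : ∀ x z → toBool (pick x one z) ≡ toBool x ∨ toBool z
toBool-pick-∨ one z = refl
toBool-pick-∨ two z = refl

Agree : (ℕ → Two) → (ℕ → Bool) → Set
Agree v w = ∀ X → toBool (v X) ≡ w X

_≅_ : Fm → PFm → Set
F ≅ P = ∀ {v w} → Agree v w → toBool (⟦ F ⟧ v) ≡ evalₚ w P

•-≅ : ∀ F → F ≅ (F •)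
•-≅ (var X pid) agree = agree X
•-≅ (var X swp) {v} agree = trans (toBool-swp (v X)) (cong not (agree X))
•-≅ (e one) agree = refl
•-≅ (e two) agree = refl
•-≅ (q F G H) {v} agree =
  trans (toBool-pick (⟦ F ⟧ v) (⟦ G ⟧ v) (⟦ H ⟧ v))
    (cong₂ _∨_ (cong₂ _∧_ (•-≅ F agree) (•-≅ G agree)) (cong₂ _∧_ (cong not (•-≅ F agree)) (•-≅ H agree)))

°-≅ : ∀ P → (P °) ≅ P
°-≅ 𝟘 agree = refl
°-≅ 𝟙 agree = refl
°-≅ (pv X) agree = agree X
°-≅ (¬ₚ P) {v} agree =
  trans (cong toBool (⟦^⟧ (P °) swp v)) (trans (toBool-swp (⟦ P ° ⟧ v)) (cong not (°-≅ P agree)))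
°-≅ (P ∧ₚ Q) {v} agree = trans (toBool-pick-∧ (⟦ P ° ⟧ v) (⟦ Q ° ⟧ v)) (cong₂ _∧_ (°-≅ P agree) (°-≅ Q agree))
°-≅ (P ∨ₚ Q) {v} agree = trans (toBool-pick-∨ (⟦ P ° ⟧ v) (⟦ Q ° ⟧ v)) (cong₂ _∨_ (°-≅ P agree) (°-≅ Q agree))

•-pointwise : ∀ Γ → Pointwise _≅_ Γ (Γ •ˢ)
•-pointwise [] = []
•-pointwise (F ∷ Γ) = •-≅ F ∷ •-pointwise Γ

°-pointwise : ∀ Γ → Pointwise _≅_ (Γ °ˢ) Γ
°-pointwise [] = []
°-pointwise (P ∷ Γ) = °-≅ P ∷ °-pointwise Γ

module _ {A B : Set} {R : A → B → Set} {P : A → Set} {Q : B → Set} (P⇔Q : ∀ {x y} → R x y → P x ⇔ Q y) where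

  Pointwise-All⇔ : ∀ {xs ys} → Pointwise R xs ys → All P xs ⇔ All Q ys
  Pointwise-All⇔ [] = mk⇔ (λ _ → []) (λ _ → [])
  Pointwise-All⇔ (r ∷ rs) =
    mk⇔ (λ { (p ∷ ps) → to (P⇔Q r) p ∷ to (Pointwise-All⇔ rs) ps })
        (λ { (b ∷ bs) → from (P⇔Q r) b ∷ from (Pointwise-All⇔ rs) bs })

  Pointwise-Any⇔ : ∀ {xs ys} → Pointwise R xs ys → Any P xs ⇔ Any Q ys
  Pointwise-Any⇔ [] = mk⇔ (λ ()) (λ ())
  Pointwise-Any⇔ (r ∷ rs) =
    mk⇔ (λ { (here p) → here (to (P⇔Q r) p) ; (there h) → there (to (Pointwise-Any⇔ rs) h) })
        (λ { (here b) → here (from (P⇔Q r) b) ; (there h) → there (from (Pointwise-Any⇔ rs) h) })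

holds⇔ : ∀ {v w} → Agree v w → ∀ {F P} → F ≅ P → ⟦ F ⟧ v ≡ one ⇔ evalₚ w P ≡ true
holds⇔ agree F≅P =
  mk⇔ (λ F≡1 → trans (sym (F≅P agree)) (cong toBool F≡1)) (λ P≡t → toBool-true (trans (F≅P agree) P≡t))

⊨₁⇔⊨ : ∀ {Γ Δ Γ' Δ'} → Pointwise _≅_ Γ Γ' → Pointwise _≅_ Δ Δ' → Γ ⊨₁ Δ ⇔ Γ' ⊨ Δ'
⊨₁⇔⊨ ΓΓ' ΔΔ' = mk⇔
  (λ V w s → to (Any⇔ (toBool-fromBool ∘ w) ΔΔ') (V (fromBool ∘ w) (from (All⇔ (toBool-fromBool ∘ w) ΓΓ') s)))
  (λ V v s → from (Any⇔ {v} (λ _ → refl) ΔΔ') (V (toBool ∘ v) (to (All⇔ {v} (λ _ → refl) ΓΓ') s)))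
  where
  All⇔ : ∀ {v w Γ Γ'} → Agree v w → Pointwise _≅_ Γ Γ' →
         All (λ F → ⟦ F ⟧ v ≡ one) Γ ⇔ All (λ P → evalₚ w P ≡ true) Γ'
  All⇔ agree = Pointwise-All⇔ (λ {F} {P} → holds⇔ agree {F} {P})
  Any⇔ : ∀ {v w Δ Δ'} → Agree v w → Pointwise _≅_ Δ Δ' →
         Any (λ F → ⟦ F ⟧ v ≡ one) Δ ⇔ Any (λ P → evalₚ w P ≡ true) Δ'
  Any⇔ agree = Pointwise-Any⇔ (λ {F} {P} → holds⇔ agree {F} {P})

corollary5p2 : (Γ Δ : List Fm) (Γ₁ Δ₁ : List PFm) →
    ((Γ ⊨₁ Δ ⇔ (Γ •ˢ) ⊨ (Δ •ˢ)) × (Γ₁ ⊨ Δ₁ ⇔ (Γ₁ °ˢ) ⊨₁ (Δ₁ °ˢ)))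
    × ((Γ ⊢[ one ] Δ ⇔ (Γ •ˢ) ⊢ₚ (Δ •ˢ)) × (Γ₁ ⊢ₚ Δ₁ ⇔ (Γ₁ °ˢ) ⊢[ one ] (Δ₁ °ˢ)))
corollary5p2 Γ Δ Γ₁ Δ₁ =
  (⊨₁⇔⊨• , ⊨⇔⊨₁°) ,
  (⇔-trans ⊢₁⇔⊨₁ (⇔-trans ⊨₁⇔⊨• (⇔-sym ⊢ₚ⇔⊨)) , ⇔-trans ⊢ₚ⇔⊨ (⇔-trans ⊨⇔⊨₁° (⇔-sym ⊢₁⇔⊨₁)))
  where
  ⊢₁⇔⊨₁ : ∀ {Γ Δ} → Γ ⊢₁ Δ ⇔ Γ ⊨₁ Δ
  ⊢₁⇔⊨₁ = mk⇔ sound complete₁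
  ⊢ₚ⇔⊨ : ∀ {Γ Δ} → Γ ⊢ₚ Δ ⇔ Γ ⊨ Δ
  ⊢ₚ⇔⊨ = mk⇔ soundₚ completeₚ
  ⊨₁⇔⊨• : Γ ⊨₁ Δ ⇔ (Γ •ˢ) ⊨ (Δ •ˢ)
  ⊨₁⇔⊨• = ⊨₁⇔⊨ (•-pointwise Γ) (•-pointwise Δ)
  ⊨⇔⊨₁° : Γ₁ ⊨ Δ₁ ⇔ (Γ₁ °ˢ) ⊨₁ (Δ₁ °ˢ)
  ⊨⇔⊨₁° = ⇔-sym (⊨₁⇔⊨ (°-pointwise Γ₁) (°-pointwise Δ₁))
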